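{- Let $m\geq 7$ be an odd integer and let $n\geq 4m$ be a sufficiently large integer. Let $G$ be a graph on $3n+4$ vertices such that $G$ contains no copy of $\mathbb{K}_{2,n}$ and the complement $\overline{G}$ contains no copy of $W_m$. Then the minimum degree of $G$ satisfies $\delta(G)< \sqrt{3}(n+1)$.
   Context: All graphs are finite, simple and undirected. $\mathbb{K}_{2,n}$ is the complete bipartite graph with parts of sizes $2$ and $n$. The wheel $W_m$ is the graph on $m+1$ vertices obtained from the cycle $C_m$ by adding a new vertex adjacent to all vertices of the cycle. "Contains a copy" means as a (not necessarily induced) subgraph. -}

module Defs where

open import Data.Nat using (ℕ; zero; suc; _+_; _*_; _⊓_; _<ᵇ_; _≡ᵇ_)
open import Data.Fin using (Fin; zero; suc; toℕ; _≟_)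
open import Data.Bool using (Bool; true; false; not; _∧_; _∨_; _xor_; if_then_else_)
open import Data.List using (map; allFin)
open import Data.Nat.ListAction using (sum)
open import Data.Product using (Σ; _×_)
open import Relation.Nullary.Decidable using (⌊_⌋)
open import Relation.Binary.PropositionalEquality using (_≡_)
open import Function.Definitions using (Injective)

record Graph (v : ℕ) : Set where
  field
    adj    : Fin v → Fin v → Bool
    sym    : ∀ x y → adj x y ≡ adj y x
    irrefl : ∀ x → adj x x ≡ false
open Graph public

compAdj : ∀ {v} → Graph v → Fin v → Fin v → Bool
compAdj G x y = not (adj G x y) ∧ not ⌊ x ≟ y ⌋

degree : ∀ {v} → Graph v → Fin v → ℕ
degree {v} G x = sum (map (λ y → if adj G x y then 1 else 0) (allFin v))

minFin : ∀ k → (Fin (suc k) → ℕ) → ℕ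
minFin zero f = f zero
minFin (suc k) f = f zero ⊓ minFin k (λ i → f (suc i))

minDegree : ∀ {k} → Graph (suc k) → ℕ
minDegree {k} G = minFin k (degree G)

-- H (adjacency on Fin h) has a copy in G (adjacency on Fin v) as a
-- (not necessarily induced) subgraph: an injective vertex map sending edges to edges.
ContainsCopy : ∀ {h v} → (Fin h → Fin h → Bool) → (Fin v → Fin v → Bool) → Set
ContainsCopy {h} {v} H G =
  Σ (Fin h → Fin v) λ f → Injective _≡_ _≡_ f × (∀ i j → H i j ≡ true → G (f i) (f j) ≡ true)

-- K_{2,n} on Fin (2 + n): vertices 0,1 form one part, the rest the other part.
K2 : (n : ℕ) → Fin (2 + n) → Fin (2 + n) → Bool
K2 n i j = (toℕ i <ᵇ 2) xor (toℕ j <ᵇ 2)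

-- the cycle C_m on Fin m (i ~ i+1 mod m); a genuine cycle for m ≥ 3
cycleAdj : (m : ℕ) → Fin m → Fin m → Bool
cycleAdj m i j =
  (suc (toℕ i) ≡ᵇ toℕ j) ∨ (suc (toℕ j) ≡ᵇ toℕ i)
  ∨ ((toℕ i ≡ᵇ 0) ∧ (suc (toℕ j) ≡ᵇ m)) ∨ ((toℕ j ≡ᵇ 0) ∧ (suc (toℕ i) ≡ᵇ m))

wheel : (m : ℕ) → Fin (suc m) → Fin (suc m) → Bool
wheel m zero zero = false
wheel m zero (suc j) = true
wheel m (suc i) zero = true
wheel m (suc i) (suc j) = cycleAdj m i j

{-# OPTIONS --safe #-}
-- Double counting paths of length two in G on v vertices: Σ_w d(w)² = Σ_{x,y} codeg(x,y).
-- The diagonal terms sum to Σ_w d(w), and since G has no K_{2,n} each of the v(v−1)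
-- off-diagonal codegrees is at most n − 1. As t ↦ t² − t is increasing, summing
-- δ² − δ ≤ d(w)² − d(w) gives δ² ≤ (v − 1)(n − 1) + δ ≤ (v − 1) n, which for v = 3n + 4 is
-- (3n + 3) n < 3 (n + 1)².
module Submission where

open import Defs
open import Data.Nat using (ℕ; zero; suc; _+_; _*_; _≤_; _<_; z≤n; s≤s; _≤?_)
open import Data.Nat.Properties
  using ( +-*-semiring; +-comm; +-assoc; +-identityʳ; *-identityʳ; *-suc; *-distribˡ-+
        ; ≤-refl; ≤-trans; ≤-<-trans; ≤-pred; ≰⇒>; m≤n⇒m<n∨m≡n; m≤m+n; m<m+n; m⊓n≤m; m⊓n≤n
        ; +-mono-≤; +-monoˡ-≤; +-monoʳ-≤; *-monoˡ-≤; *-monoʳ-≤; +-cancelˡ-≤; *-cancelˡ-≤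
        ; module ≤-Reasoning )
open import Data.Fin using (Fin; zero; suc; punchIn)
open import Data.Fin.Properties using (suc-injective; punchInᵢ≢i)
open import Data.Bool using (Bool; true; false; _∧_; if_then_else_)
open import Data.Bool.Properties using (∧-idem; ∧-conicalˡ; ∧-conicalʳ)
open import Data.List using (map; tabulate; allFin)
open import Data.List.Properties using (map-tabulate)
import Data.Nat.ListAction as List
open import Data.Vec.Functional using (Vector; _∷_; removeAt)
open import Data.Product using (Σ; ∃; _,_; _×_)
open import Data.Sum using (inj₁; inj₂)
open import Function using (_∘_; id)
open import Function.Definitions using (Injective)
open import Relation.Nullary using (¬_; yes; no; contradiction)
open import Relation.Binary.PropositionalEquality as ≡ using (_≡_; _≢_; refl; cong; cong₂; subst)
open import Data.Nat.Tactic.RingSolver using (solve-∀)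
open import Algebra.Properties.Semiring.Sum +-*-semiring
  using (sum; sum-syntax; sum-cong-≗; sum-remove; ∑-comm; ∑-distrib-+; *-distribˡ-sum; *-distribʳ-sum)

𝟙 : Bool → ℕ
𝟙 b = if b then 1 else 0

𝟙-∧ : ∀ b c → 𝟙 (b ∧ c) ≡ 𝟙 b * 𝟙 c
𝟙-∧ true  c = ≡.sym (+-identityʳ (𝟙 c))
𝟙-∧ false c = refl

𝟙≤1 : ∀ b → 𝟙 b ≤ 1
𝟙≤1 true  = ≤-refl
𝟙≤1 false = z≤n

∑-mono-≤ : ∀ {k} {f g : Vector ℕ k} → (∀ i → f i ≤ g i) → sum f ≤ sum g
∑-mono-≤ {zero}  f≤g = z≤n
∑-mono-≤ {suc k} f≤g = +-mono-≤ (f≤g zero) (∑-mono-≤ (f≤g ∘ suc))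

∑-const : ∀ k c → ∑[ i < k ] c ≡ k * c
∑-const zero    c = refl
∑-const (suc k) c = cong (c +_) (∑-const k c)

∑-≤-except : ∀ {k} (f : Vector ℕ (suc k)) i {c} → (∀ j → j ≢ i → f j ≤ c) →
             sum f ≤ f i + k * c
∑-≤-except {k} f i {c} f≤c = begin
  sum f                    ≡⟨ sum-remove f ⟩
  f i + sum (removeAt f i) ≤⟨ +-monoʳ-≤ (f i) (∑-mono-≤ (λ j → f≤c (punchIn i j) (punchInᵢ≢i i j))) ⟩
  f i + ∑[ j < k ] c       ≡⟨ cong (f i +_) (∑-const k c) ⟩
  f i + k * c              ∎
  where open ≤-Reasoning

sum-map-allFin : ∀ {k} (f : Vector ℕ k) → List.sum (map f (allFin k)) ≡ sum f
sum-map-allFin {k} f = ≡.trans (cong List.sum (map-tabulate id f)) (sum-tabulate f)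
  where
  sum-tabulate : ∀ {k} (f : Vector ℕ k) → List.sum (tabulate f) ≡ sum f
  sum-tabulate {zero}  f = refl
  sum-tabulate {suc k} f = cong (f zero +_) (sum-tabulate (f ∘ suc))

m≤n⇒m*m+n≤n*n+m : ∀ {m n} → m ≤ n → m * m + n ≤ n * n + m
m≤n⇒m*m+n≤n*n+m {m} {n} m≤n with m≤n⇒m<n∨m≡n m≤n
... | inj₂ refl = ≤-refl
... | inj₁ m<n  = begin
  m * m + n  ≤⟨ +-monoˡ-≤ n (*-monoʳ-≤ m m≤n) ⟩
  m * n + n  ≡⟨ +-comm (m * n) n ⟩
  suc m * n  ≤⟨ *-monoˡ-≤ n m<n ⟩
  n * n      ≤⟨ m≤m+n (n * n) m ⟩
  n * n + m  ∎
  where open ≤-Reasoning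

minFin≤ : ∀ k (f : Vector ℕ (suc k)) i → minFin k f ≤ f i
minFin≤ zero    f zero    = ≤-refl
minFin≤ (suc k) f zero    = m⊓n≤m (f zero) _
minFin≤ (suc k) f (suc i) = ≤-trans (m⊓n≤n (f zero) _) (minFin≤ k (f ∘ suc) i)

∑𝟙≥⇒injection : ∀ {N} (P : Fin N → Bool) k → k ≤ ∑[ i < N ] 𝟙 (P i) →
                Σ (Fin k → Fin N) λ g → Injective _≡_ _≡_ g × (∀ i → P (g i) ≡ true)
∑𝟙≥⇒injection {zero} P zero z≤n = (λ ()) , (λ { {()} }) , (λ ())
∑𝟙≥⇒injection {suc N} P k k≤ with P zero in P0
... | false with ∑𝟙≥⇒injection (P ∘ suc) k k≤
...   | g , g-inj , Pg = suc ∘ g , g-inj ∘ suc-injective , Pg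
∑𝟙≥⇒injection {suc N} P zero    _        | true = (λ ()) , (λ { {()} }) , (λ ())
∑𝟙≥⇒injection {suc N} P (suc k) (s≤s k≤) | true with ∑𝟙≥⇒injection (P ∘ suc) k k≤
... | g , g-inj , Pg = g′ , g′-inj , Pg′
  where
  g′ : Fin (suc k) → Fin (suc N)
  g′ = zero ∷ suc ∘ g
  g′-inj : Injective _≡_ _≡_ g′
  g′-inj {zero}  {zero}  _  = refl
  g′-inj {suc i} {suc j} eq = cong suc (g-inj (suc-injective eq))
  Pg′ : ∀ i → P (g′ i) ≡ true
  Pg′ zero    = P0
  Pg′ (suc i) = Pg i

module _ {v : ℕ} (G : Graph v) where

  codegree : Fin v → Fin v → ℕ
  codegree x y = ∑[ w < v ] 𝟙 (adj G x w ∧ adj G y w)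

  degree≡∑ : ∀ x → degree G x ≡ ∑[ y < v ] 𝟙 (adj G x y)
  degree≡∑ x = sum-map-allFin (λ y → 𝟙 (adj G x y))

  codegree-diagonal : ∀ x → codegree x x ≡ degree G x
  codegree-diagonal x =
    ≡.trans (sum-cong-≗ (λ w → cong 𝟙 (∧-idem (adj G x w)))) (≡.sym (degree≡∑ x))

  ∑degree²≡∑∑codegree :
    ∑[ w < v ] (degree G w * degree G w) ≡ ∑[ x < v ] ∑[ y < v ] codegree x y
  ∑degree²≡∑∑codegree = begin
    ∑[ w < v ] (degree G w * degree G w)                    ≡⟨ sum-cong-≗ degree²≡ ⟩
    ∑[ w < v ] ∑[ x < v ] ∑[ y < v ] (a w x * a w y)        ≡⟨ ∑-comm (λ w x → ∑[ y < v ] (a w x * a w y)) ⟩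
    ∑[ x < v ] ∑[ w < v ] ∑[ y < v ] (a w x * a w y)        ≡⟨ sum-cong-≗ (λ x → ∑-comm (λ w y → a w x * a w y)) ⟩
    ∑[ x < v ] ∑[ y < v ] ∑[ w < v ] (a w x * a w y)        ≡⟨ sum-cong-≗ (λ x → sum-cong-≗ (λ y → sum-cong-≗ (common x y))) ⟩
    ∑[ x < v ] ∑[ y < v ] codegree x y                      ∎
    where
    open ≡.≡-Reasoning
    a : Fin v → Fin v → ℕ
    a w x = 𝟙 (adj G w x)
    degree²≡ : ∀ w → degree G w * degree G w ≡ ∑[ x < v ] ∑[ y < v ] (a w x * a w y)
    degree²≡ w = begin
      degree G w * degree G w                 ≡⟨ cong₂ _*_ (degree≡∑ w) (degree≡∑ w) ⟩
      (∑[ x < v ] a w x) * (∑[ y < v ] a w y) ≡⟨ *-distribʳ-sum _ (a w) ⟩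
      ∑[ x < v ] (a w x * ∑[ y < v ] a w y)   ≡⟨ sum-cong-≗ (λ x → *-distribˡ-sum (a w x) (a w)) ⟩
      ∑[ x < v ] ∑[ y < v ] (a w x * a w y)   ∎
    common : ∀ x y w → a w x * a w y ≡ 𝟙 (adj G x w ∧ adj G y w)
    common x y w = begin
      a w x * a w y                 ≡⟨ 𝟙-∧ (adj G w x) (adj G w y) ⟨
      𝟙 (adj G w x ∧ adj G w y)     ≡⟨ cong₂ (λ p q → 𝟙 (p ∧ q)) (sym G w x) (sym G w y) ⟩
      𝟙 (adj G x w ∧ adj G y w)     ∎

  adj⇒≢ : ∀ {x y} → adj G x y ≡ true → x ≢ y
  adj⇒≢ {x} xy refl with ≡.trans (≡.sym xy) (irrefl G x)
  ... | ()

  commonNeighbours⇒K2 : ∀ {n x y} → x ≢ y → (g : Fin n → Fin v) → Injective _≡_ _≡_ g →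
                        (∀ i → adj G x (g i) ≡ true) → (∀ i → adj G y (g i) ≡ true) →
                        ContainsCopy (K2 n) (adj G)
  commonNeighbours⇒K2 {n} {x} {y} x≢y g g-inj xg yg = f , f-inj , f-edge
    where
    f : Fin (2 + n) → Fin v
    f = x ∷ y ∷ g
    f-inj : Injective _≡_ _≡_ f
    f-inj {zero}        {zero}        _  = refl
    f-inj {zero}        {suc zero}    eq = contradiction eq x≢y
    f-inj {zero}        {suc (suc j)} eq = contradiction eq (adj⇒≢ (xg j))
    f-inj {suc zero}    {zero}        eq = contradiction (≡.sym eq) x≢y
    f-inj {suc zero}    {suc zero}    _  = refl
    f-inj {suc zero}    {suc (suc j)} eq = contradiction eq (adj⇒≢ (yg j))
    f-inj {suc (suc i)} {zero}        eq = contradiction (≡.sym eq) (adj⇒≢ (xg i))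
    f-inj {suc (suc i)} {suc zero}    eq = contradiction (≡.sym eq) (adj⇒≢ (yg i))
    f-inj {suc (suc i)} {suc (suc j)} eq = cong (λ k → suc (suc k)) (g-inj eq)
    f-edge : ∀ i j → K2 n i j ≡ true → adj G (f i) (f j) ≡ true
    f-edge zero          (suc (suc j)) _ = xg j
    f-edge (suc zero)    (suc (suc j)) _ = yg j
    f-edge (suc (suc i)) zero          _ = ≡.trans (sym G (g i) x) (xg i)
    f-edge (suc (suc i)) (suc zero)    _ = ≡.trans (sym G (g i) y) (yg i)

  K2-free⇒codegree< : ∀ {n} → ¬ ContainsCopy (K2 n) (adj G) → ∀ {x y} → x ≢ y → codegree x y < n
  K2-free⇒codegree< {n} noK2 {x} {y} x≢y with n ≤? codegree x y
  ... | no  n≰ = ≰⇒> n≰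
  ... | yes n≤ with ∑𝟙≥⇒injection (λ w → adj G x w ∧ adj G y w) n n≤
  ...   | g , g-inj , xyg = contradiction
          (commonNeighbours⇒K2 x≢y g g-inj (λ i → ∧-conicalˡ _ _ (xyg i)) (λ i → ∧-conicalʳ _ _ (xyg i)))
          noK2

module _ {k : ℕ} (G : Graph (suc k)) where

  private
    δ : ℕ
    δ = minDegree G

  degree≤ : ∀ x → degree G x ≤ k
  degree≤ x = begin
    degree G x                   ≡⟨ degree≡∑ G x ⟩
    ∑[ y < suc k ] 𝟙 (adj G x y) ≤⟨ ∑-≤-except _ x (λ y _ → 𝟙≤1 (adj G x y)) ⟩
    𝟙 (adj G x x) + k * 1        ≡⟨ cong (λ b → 𝟙 b + k * 1) (irrefl G x) ⟩
    k * 1                        ≡⟨ *-identityʳ k ⟩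
    k                            ∎
    where open ≤-Reasoning

  minDegree≤degree : ∀ x → δ ≤ degree G x
  minDegree≤degree = minFin≤ k (degree G)

  ∑degree²≤ : ∀ {c} → (∀ {x y} → x ≢ y → codegree G x y ≤ c) →
              ∑[ w < suc k ] (degree G w * degree G w)
                ≤ ∑[ w < suc k ] degree G w + suc k * (k * c)
  ∑degree²≤ {c} codegree≤ = begin
    ∑[ w < suc k ] (degree G w * degree G w)                  ≡⟨ ∑degree²≡∑∑codegree G ⟩
    ∑[ x < suc k ] ∑[ y < suc k ] codegree G x y              ≤⟨ ∑-mono-≤ row≤ ⟩
    ∑[ x < suc k ] (codegree G x x + k * c)                   ≡⟨ ∑-distrib-+ (λ x → codegree G x x) (λ _ → k * c) ⟩
    ∑[ x < suc k ] codegree G x x + ∑[ x < suc k ] (k * c)    ≡⟨ cong₂ _+_ (sum-cong-≗ (codegree-diagonal G))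
                                                                           (∑-const (suc k) (k * c)) ⟩
    ∑[ w < suc k ] degree G w + suc k * (k * c)               ∎
    where
    open ≤-Reasoning
    row≤ : ∀ x → ∑[ y < suc k ] codegree G x y ≤ codegree G x x + k * c
    row≤ x = ∑-≤-except (codegree G x) x (λ y y≢x → codegree≤ (y≢x ∘ ≡.sym))

  minDegree²≤ : ∀ {c} → (∀ {x y} → x ≢ y → codegree G x y ≤ c) → δ * δ ≤ k * c + δ
  minDegree²≤ {c} codegree≤ = *-cancelˡ-≤ (suc k) (+-cancelˡ-≤ ∑d _ _ counted)
    where
    open ≤-Reasoning
    d : Fin (suc k) → ℕ
    d = degree G
    ∑d = ∑[ w < suc k ] d w
    counted : ∑d + suc k * (δ * δ) ≤ ∑d + suc k * (k * c + δ)
    counted = begin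
      ∑d + suc k * (δ * δ)                         ≡⟨ +-comm ∑d _ ⟩
      suc k * (δ * δ) + ∑d                         ≡⟨ cong (_+ ∑d) (∑-const (suc k) (δ * δ)) ⟨
      ∑[ w < suc k ] (δ * δ) + ∑d                  ≡⟨ ∑-distrib-+ (λ _ → δ * δ) d ⟨
      ∑[ w < suc k ] (δ * δ + d w)                 ≤⟨ ∑-mono-≤ (λ w → m≤n⇒m*m+n≤n*n+m (minDegree≤degree w)) ⟩
      ∑[ w < suc k ] (d w * d w + δ)               ≡⟨ ∑-distrib-+ (λ w → d w * d w) (λ _ → δ) ⟩
      ∑[ w < suc k ] (d w * d w) + ∑[ w < suc k ] δ ≡⟨ cong (∑[ w < suc k ] (d w * d w) +_) (∑-const (suc k) δ) ⟩
      ∑[ w < suc k ] (d w * d w) + suc k * δ       ≤⟨ +-monoˡ-≤ (suc k * δ) (∑degree²≤ codegree≤) ⟩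
      ∑d + suc k * (k * c) + suc k * δ             ≡⟨ +-assoc ∑d _ _ ⟩
      ∑d + (suc k * (k * c) + suc k * δ)           ≡⟨ cong (∑d +_) (*-distribˡ-+ (suc k) (k * c) δ) ⟨
      ∑d + suc k * (k * c + δ)                     ∎

  K2-free⇒minDegree²≤ : ∀ {c} → ¬ ContainsCopy (K2 (suc c)) (adj G) → δ * δ ≤ k * suc c
  K2-free⇒minDegree²≤ {c} noK2 = begin
    δ * δ      ≤⟨ minDegree²≤ (≤-pred ∘ K2-free⇒codegree< G noK2) ⟩
    k * c + δ  ≤⟨ +-monoʳ-≤ (k * c) (≤-trans (minDegree≤degree zero) (degree≤ zero)) ⟩
    k * c + k  ≡⟨ +-comm (k * c) k ⟩
    k + k * c  ≡⟨ *-suc k c ⟨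
    k * suc c  ∎
    where open ≤-Reasoning

[3+3n]n<3[n+1]² : ∀ n → (3 + 3 * n) * n < 3 * ((n + 1) * (n + 1))
[3+3n]n<3[n+1]² n = subst ((3 + 3 * n) * n <_) (expand n) (m<m+n _ (s≤s z≤n))
  where
  expand : ∀ n → (3 + 3 * n) * n + suc (3 * n + 2) ≡ 3 * ((n + 1) * (n + 1))
  expand = solve-∀

lemma3p2 : (m : ℕ) → 7 ≤ m → (∃ λ k → m ≡ suc (2 * k)) →
    Σ ℕ λ N → (n : ℕ) → N ≤ n → 4 * m ≤ n →
      (G : Graph (4 + 3 * n)) →
      ¬ ContainsCopy (K2 n) (adj G) →
      ¬ ContainsCopy (wheel m) (compAdj G) →
      minDegree G * minDegree G < 3 * ((n + 1) * (n + 1))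
lemma3p2 _ _ _ = 1 , λ where
  zero    () _ _ _ _
  (suc c) _ _ G noK2 _ → ≤-<-trans (K2-free⇒minDegree²≤ G noK2) ([3+3n]n<3[n+1]² (suc c))
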